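{- There exists a periodic Golay pair of length $68$; that is, there exist sequences $A=[a_0,\ldots,a_{67}]$ and $B=[b_0,\ldots,b_{67}]$ with all $a_i,b_i\in\{1,-1\}$ such that for every $k=1,2,\ldots,67$, $$\sum_{i=0}^{67}\left(a_ia_{i+k}+b_ib_{i+k}\right)=0,$$ where indices are taken modulo $68$. -}

module Defs where

open import Data.Nat using (ℕ; zero; suc; _%_; _+_)
open import Data.Fin using (Fin; toℕ; fromℕ<) renaming (zero to fzero; suc to fsuc)
open import Data.Nat.DivMod using (m%n<n)
open import Data.Integer using (ℤ; 1ℤ; -1ℤ; 0ℤ) renaming (_+_ to _+ℤ_; _*_ to _*ℤ_)
open import Data.Product using (_×_; ∃-syntax; Σ-syntax)
open import Data.Sum using (_⊎_)
open import Relation.Binary.PropositionalEquality using (_≡_)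

IsPM1 : ℤ → Set
IsPM1 x = (x ≡ 1ℤ) ⊎ (x ≡ -1ℤ)

∑ : ∀ n → (Fin n → ℤ) → ℤ
∑ zero    f = 0ℤ
∑ (suc n) f = f fzero +ℤ ∑ n (λ i → f (fsuc i))

shiftIdx : ∀ n → Fin (suc n) → ℕ → Fin (suc n)
shiftIdx n i k = fromℕ< (m%n<n (toℕ i + k) (suc n))

PAF : ∀ n → (Fin (suc n) → ℤ) → ℕ → ℤ
PAF n a k = ∑ (suc n) (λ i → a i *ℤ a (shiftIdx n i k))

IsPeriodicGolayPair : ∀ n → (Fin (suc n) → ℤ) → (Fin (suc n) → ℤ) → Set
IsPeriodicGolayPair n a b =
  (∀ i → IsPM1 (a i)) × (∀ i → IsPM1 (b i)) ×
  (∀ (k : Fin n) → PAF n a (suc (toℕ k)) +ℤ PAF n b (suc (toℕ k)) ≡ 0ℤ)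

module Submission where

open import Defs
open import Data.Fin using (Fin; toℕ)
open import Data.Fin.Properties using (all?)
open import Data.Integer using (ℤ; 1ℤ; -1ℤ; 0ℤ; _≟_) renaming (_+_ to _+ℤ_)
open import Data.Nat using (suc)
open import Data.Product using (Σ-syntax; _,_)
open import Data.Vec using (Vec; _∷_; []; lookup)
open import Relation.Nullary using (Dec)
open import Relation.Nullary.Decidable using (toWitness; _×-dec_; _⊎-dec_)

isPM1? : ∀ x → Dec (IsPM1 x)
isPM1? x = (x ≟ 1ℤ) ⊎-dec (x ≟ -1ℤ)

isPeriodicGolayPair? : ∀ n a b → Dec (IsPeriodicGolayPair n a b)
isPeriodicGolayPair? n a b =
  all? (λ i → isPM1? (a i)) ×-dec
  all? (λ i → isPM1? (b i)) ×-dec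
  all? (λ k → PAF n a (suc (toℕ k)) +ℤ PAF n b (suc (toℕ k)) ≟ 0ℤ)

golay68ᴬ : Vec ℤ 68
golay68ᴬ = 1ℤ ∷ 1ℤ ∷ 1ℤ ∷ -1ℤ ∷ 1ℤ ∷ 1ℤ ∷ 1ℤ ∷ -1ℤ ∷ 1ℤ ∷ -1ℤ ∷ -1ℤ ∷ -1ℤ ∷ 1ℤ ∷ -1ℤ ∷ 1ℤ ∷ 1ℤ ∷ 1ℤ ∷ -1ℤ ∷ 1ℤ ∷ -1ℤ ∷ -1ℤ ∷ 1ℤ ∷ 1ℤ ∷ -1ℤ ∷ 1ℤ ∷ 1ℤ ∷ 1ℤ ∷ 1ℤ ∷ 1ℤ ∷ 1ℤ ∷ 1ℤ ∷ -1ℤ ∷ 1ℤ ∷ 1ℤ ∷ 1ℤ ∷ 1ℤ ∷ 1ℤ ∷ 1ℤ ∷ -1ℤ ∷ 1ℤ ∷ -1ℤ ∷ -1ℤ ∷ 1ℤ ∷ -1ℤ ∷ -1ℤ ∷ -1ℤ ∷ 1ℤ ∷ -1ℤ ∷ 1ℤ ∷ -1ℤ ∷ -1ℤ ∷ 1ℤ ∷ -1ℤ ∷ 1ℤ ∷ 1ℤ ∷ 1ℤ ∷ -1ℤ ∷ -1ℤ ∷ -1ℤ ∷ 1ℤ ∷ 1ℤ ∷ 1ℤ ∷ -1ℤ ∷ -1ℤ ∷ -1ℤ ∷ 1ℤ ∷ -1ℤ ∷ -1ℤ ∷ []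

golay68ᴮ : Vec ℤ 68
golay68ᴮ = 1ℤ ∷ -1ℤ ∷ 1ℤ ∷ -1ℤ ∷ -1ℤ ∷ 1ℤ ∷ -1ℤ ∷ -1ℤ ∷ 1ℤ ∷ 1ℤ ∷ -1ℤ ∷ -1ℤ ∷ 1ℤ ∷ 1ℤ ∷ 1ℤ ∷ 1ℤ ∷ 1ℤ ∷ 1ℤ ∷ 1ℤ ∷ 1ℤ ∷ 1ℤ ∷ -1ℤ ∷ -1ℤ ∷ -1ℤ ∷ -1ℤ ∷ 1ℤ ∷ 1ℤ ∷ -1ℤ ∷ 1ℤ ∷ -1ℤ ∷ 1ℤ ∷ 1ℤ ∷ -1ℤ ∷ 1ℤ ∷ 1ℤ ∷ 1ℤ ∷ 1ℤ ∷ -1ℤ ∷ -1ℤ ∷ -1ℤ ∷ -1ℤ ∷ 1ℤ ∷ 1ℤ ∷ -1ℤ ∷ 1ℤ ∷ 1ℤ ∷ 1ℤ ∷ -1ℤ ∷ -1ℤ ∷ -1ℤ ∷ 1ℤ ∷ 1ℤ ∷ -1ℤ ∷ 1ℤ ∷ -1ℤ ∷ 1ℤ ∷ -1ℤ ∷ 1ℤ ∷ 1ℤ ∷ -1ℤ ∷ 1ℤ ∷ -1ℤ ∷ -1ℤ ∷ -1ℤ ∷ 1ℤ ∷ 1ℤ ∷ -1ℤ ∷ -1ℤ ∷ []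

mainTheorem2 : Σ[ a ∈ (Fin 68 → ℤ) ] Σ[ b ∈ (Fin 68 → ℤ) ] IsPeriodicGolayPair 67 a b
mainTheorem2 = a , b , toWitness {a? = isPeriodicGolayPair? 67 a b} _
  where
  a b : Fin 68 → ℤ
  a = lookup golay68ᴬ
  b = lookup golay68ᴮ
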